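{- Let $\{GM_n\}$ be the Gaussian Tetranacci numbers (see context). For every integer $n\ge1$: (a) $\sum_{k=1}^{n}GM_{k}=\frac{1}{3}(GM_{n+2}+2GM_{n}+GM_{n-1}-(1+i))$; (b) $\sum_{k=1}^{n}GM_{2k+1}=\frac{1}{3}(2GM_{2n+2}+GM_{2n}-GM_{2n-1}-2-2i)$; (c) $\sum_{k=1}^{n}GM_{2k}=\frac{1}{3}(2GM_{2n+1}+GM_{2n-1}-GM_{2n-2}-2+i)$.
   Context: The Tetranacci numbers $M_n$ satisfy $M_n=M_{n-1}+M_{n-2}+M_{n-3}+M_{n-4}$ for all integers $n$ with $M_0=0,M_1=1,M_2=1,M_3=2$ (extended to negative indices so the recurrence holds for all $n\in\mathbb{Z}$). The Gaussian Tetranacci numbers are $GM_n=M_n+iM_{n-1}$ for all integers $n$; equivalently $GM_n=GM_{n-1}+GM_{n-2}+GM_{n-3}+GM_{n-4}$ with $GM_0=0$, $GM_1=1$, $GM_2=1+i$, $GM_3=2+i$. -}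

module Defs where

open import Data.Nat as ℕ using (ℕ; zero; suc)
open import Data.Integer as ℤ using (ℤ; +_; -[1+_])
open import Data.Product using (_×_; _,_)

-- Tetranacci numbers on nonnegative indices, computed as a 4-tuple
-- (M n , M (n+1) , M (n+2) , M (n+3)).
tetraFwd : ℕ → ℤ × ℤ × ℤ × ℤ
tetraFwd zero = (+ 0 , + 1 , + 1 , + 2)
tetraFwd (suc n) with tetraFwd n
... | (a , b , c , d) = (b , c , d , a ℤ.+ b ℤ.+ c ℤ.+ d)

-- Tetranacci numbers on negative indices, via the backward recurrence
-- M (k-4) = M k - M (k-1) - M (k-2) - M (k-3).
-- tetraBwd n = (M (-(n+1)) , M (-n) , M (1-n) , M (2-n)).
tetraBwd : ℕ → ℤ × ℤ × ℤ × ℤ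
tetraBwd zero = (+ 0 ℤ.- + 0 ℤ.- + 1 ℤ.- + 1 ℤ.+ + 2 , + 0 , + 1 , + 1)
  -- M(-1) = M 3 - M 2 - M 1 - M 0
tetraBwd (suc n) with tetraBwd n
... | (a , b , c , d) = (d ℤ.- c ℤ.- b ℤ.- a , a , b , c)

M : ℤ → ℤ
M (+ n) with tetraFwd n
... | (a , _ , _ , _) = a
M -[1+ n ] with tetraBwd n
... | (a , _ , _ , _) = a

record ℤ[i] : Set where
  constructor ⟨_+_i⟩
  field
    re : ℤ
    im : ℤ
open ℤ[i] public

infixl 6 _⊕_ _⊖_
_⊕_ : ℤ[i] → ℤ[i] → ℤ[i]
⟨ a + b i⟩ ⊕ ⟨ c + d i⟩ = ⟨ a ℤ.+ c + b ℤ.+ d i⟩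

_⊖_ : ℤ[i] → ℤ[i] → ℤ[i]
⟨ a + b i⟩ ⊖ ⟨ c + d i⟩ = ⟨ a ℤ.- c + b ℤ.- d i⟩

infixl 7 _·_
_·_ : ℤ → ℤ[i] → ℤ[i]
k · ⟨ a + b i⟩ = ⟨ k ℤ.* a + k ℤ.* b i⟩

GM : ℤ → ℤ[i]
GM n = ⟨ M n + M (n ℤ.- + 1) i⟩

sum1 : ℕ → (ℕ → ℤ[i]) → ℤ[i]
sum1 zero f = ⟨ + 0 + + 0 i⟩
sum1 (suc n) f = sum1 n f ⊕ f (suc n)

-- Each identity telescopes: writing its right-hand side as R n - K, the difference
-- R n - R (n-1) is three times the n-th summand, by at most two uses of the recurrence
-- (checked separately on real and imaginary parts).  This holds for every Gaussian
-- sequence obeying the Tetranacci recurrence; only the constant K depends on the sequence,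
-- through its first four terms.
module Submission where

open import Defs
open import Data.Nat as ℕ using (ℕ; _≥_; zero; suc; s≤s)
import Data.Nat.Properties as ℕP
open import Data.Integer as ℤ using (ℤ; +_)
open import Data.Integer.Tactic.RingSolver using (solve-∀)
import Data.Integer.Properties as ℤP
open import Data.Product using (_×_; _,_)
open import Function using (_∘_)
open import Relation.Binary.PropositionalEquality
open ≡-Reasoning

componentwise : ∀ {u v : ℤ[i]} → re u ≡ re v → im u ≡ im v → u ≡ v
componentwise = cong₂ ⟨_+_i⟩

⊕-identityˡ : ∀ x → ⟨ + 0 + + 0 i⟩ ⊕ x ≡ x
⊕-identityˡ x = componentwise (ℤP.+-identityˡ (re x)) (ℤP.+-identityˡ (im x))

·-distribˡ-⊕ : ∀ c x y → c · (x ⊕ y) ≡ c · x ⊕ c · y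
·-distribˡ-⊕ c x y = componentwise (ℤP.*-distribˡ-+ c (re x) (re y)) (ℤP.*-distribˡ-+ c (im x) (im y))

⊖-⊕-comm : ∀ x y z → x ⊖ y ⊕ z ≡ x ⊕ z ⊖ y
⊖-⊕-comm x y z = componentwise (lemma (re x) (re y) (re z)) (lemma (im x) (im y) (im z))
  where
  lemma : ∀ a b c → a ℤ.- b ℤ.+ c ≡ a ℤ.+ c ℤ.- b
  lemma = solve-∀

telescope : ∀ (c : ℤ) (K : ℤ[i]) (f R : ℕ → ℤ[i]) →
            c · f 1 ≡ R 0 ⊖ K →
            (∀ m → R m ⊕ c · f (2 ℕ.+ m) ≡ R (suc m)) →
            ∀ m → c · sum1 (suc m) f ≡ R m ⊖ K
telescope c K f R base step zero = trans (cong (c ·_) (⊕-identityˡ (f 1))) base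
telescope c K f R base step (suc m) = begin
  c · (sum1 (suc m) f ⊕ f (2 ℕ.+ m))    ≡⟨ ·-distribˡ-⊕ c (sum1 (suc m) f) (f (2 ℕ.+ m)) ⟩
  c · sum1 (suc m) f ⊕ c · f (2 ℕ.+ m)  ≡⟨ cong (_⊕ c · f (2 ℕ.+ m)) (telescope c K f R base step m) ⟩
  R m ⊖ K ⊕ c · f (2 ℕ.+ m)             ≡⟨ ⊖-⊕-comm (R m) K (c · f (2 ℕ.+ m)) ⟩
  R m ⊕ c · f (2 ℕ.+ m) ⊖ K             ≡⟨ cong (_⊖ K) (step m) ⟩
  R (suc m) ⊖ K                         ∎

IsTetranacci : (ℕ → ℤ) → Set
IsTetranacci x = ∀ k → x (4 ℕ.+ k) ≡ x k ℤ.+ x (1 ℕ.+ k) ℤ.+ x (2 ℕ.+ k) ℤ.+ x (3 ℕ.+ k)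

module _ (x : ℕ → ℤ) where

  sum-base : + 3 ℤ.* x 1 ≡ x 3 ℤ.+ + 2 ℤ.* x 1 ℤ.+ x 0 ℤ.- (x 3 ℤ.- x 1 ℤ.+ x 0)
  sum-base = identity (x 0) (x 1) (x 3)
    where
    identity : ∀ a b d → + 3 ℤ.* b ≡ d ℤ.+ + 2 ℤ.* b ℤ.+ a ℤ.- (d ℤ.- b ℤ.+ a)
    identity = solve-∀

  even-sum-base : + 3 ℤ.* x 2 ≡ + 2 ℤ.* x 3 ℤ.+ x 1 ℤ.- x 0 ℤ.- (+ 2 ℤ.* x 3 ℤ.+ x 1 ℤ.- x 0 ℤ.- + 3 ℤ.* x 2)
  even-sum-base = identity (x 0) (x 1) (x 2) (x 3)
    where
    identity : ∀ a b c d → + 3 ℤ.* c ≡ + 2 ℤ.* d ℤ.+ b ℤ.- a ℤ.- (+ 2 ℤ.* d ℤ.+ b ℤ.- a ℤ.- + 3 ℤ.* c)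
    identity = solve-∀

  module _ (rec : IsTetranacci x) where

    sum-step : ∀ m → x (3 ℕ.+ m) ℤ.+ + 2 ℤ.* x (1 ℕ.+ m) ℤ.+ x m ℤ.+ + 3 ℤ.* x (2 ℕ.+ m)
                     ≡ x (4 ℕ.+ m) ℤ.+ + 2 ℤ.* x (2 ℕ.+ m) ℤ.+ x (1 ℕ.+ m)
    sum-step m rewrite rec m = identity (x m) (x (1 ℕ.+ m)) (x (2 ℕ.+ m)) (x (3 ℕ.+ m))
      where
      identity : ∀ a b c d → d ℤ.+ + 2 ℤ.* b ℤ.+ a ℤ.+ + 3 ℤ.* c ≡ a ℤ.+ b ℤ.+ c ℤ.+ d ℤ.+ + 2 ℤ.* c ℤ.+ b
      identity = solve-∀

    odd-sum-base : + 3 ℤ.* x 3 ≡ + 2 ℤ.* x 4 ℤ.+ x 2 ℤ.- x 1 ℤ.- (+ 2 ℤ.* x 0 ℤ.+ x 1 ℤ.+ + 3 ℤ.* x 2 ℤ.- x 3)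
    odd-sum-base rewrite rec 0 = identity (x 0) (x 1) (x 2) (x 3)
      where
      identity : ∀ a b c d →
        + 3 ℤ.* d ≡ + 2 ℤ.* (a ℤ.+ b ℤ.+ c ℤ.+ d) ℤ.+ c ℤ.- b ℤ.- (+ 2 ℤ.* a ℤ.+ b ℤ.+ + 3 ℤ.* c ℤ.- d)
      identity = solve-∀

    -- Both the odd and the even sums telescope along R j = 2 x (j+1) + x (j-1) - x (j-2),
    -- which satisfies R (j+2) = R j + 3 x (j+2).
    stride-step : ∀ p → + 2 ℤ.* x (3 ℕ.+ p) ℤ.+ x (1 ℕ.+ p) ℤ.- x p ℤ.+ + 3 ℤ.* x (4 ℕ.+ p)
                        ≡ + 2 ℤ.* x (5 ℕ.+ p) ℤ.+ x (3 ℕ.+ p) ℤ.- x (2 ℕ.+ p)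
    stride-step p rewrite rec (1 ℕ.+ p) | rec p = identity (x p) (x (1 ℕ.+ p)) (x (2 ℕ.+ p)) (x (3 ℕ.+ p))
      where
      identity : ∀ a b c d →
        + 2 ℤ.* d ℤ.+ b ℤ.- a ℤ.+ + 3 ℤ.* (a ℤ.+ b ℤ.+ c ℤ.+ d)
        ≡ + 2 ℤ.* (b ℤ.+ c ℤ.+ d ℤ.+ (a ℤ.+ b ℤ.+ c ℤ.+ d)) ℤ.+ d ℤ.- c
      identity = solve-∀

-- Indexed by ℤ only to accommodate the index arithmetic of the formulas (n - 1, 2n - 2);
-- the recurrence is needed at nonnegative indices only.
Tetranacci : (ℤ → ℤ[i]) → Set
Tetranacci g = ∀ k → g (+ (4 ℕ.+ k)) ≡ g (+ k) ⊕ g (+ (1 ℕ.+ k)) ⊕ g (+ (2 ℕ.+ k)) ⊕ g (+ (3 ℕ.+ k))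

twice-suc : ∀ m → + 2 ℤ.* + suc m ≡ + (2 ℕ.+ 2 ℕ.* m)
twice-suc m = cong +_ (ℕP.*-suc 2 m)

at-consecutive-evens : (P : ℤ → ℤ → Set) → (∀ p → P (+ (2 ℕ.+ p)) (+ (4 ℕ.+ p))) →
                       ∀ m → P (+ 2 ℤ.* + suc m) (+ 2 ℤ.* + suc (suc m))
at-consecutive-evens P h m = subst₂ P (sym (twice-suc m)) (sym twice-suc-suc) (h (2 ℕ.* m))
  where
  twice-suc-suc : + 2 ℤ.* + suc (suc m) ≡ + (4 ℕ.+ 2 ℕ.* m)
  twice-suc-suc = trans (twice-suc (suc m)) (cong (λ k → + (2 ℕ.+ k)) (ℕP.*-suc 2 m))

sumRHS oddSumRHS evenSumRHS : (ℤ → ℤ[i]) → ℤ → ℤ[i]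
sumRHS g n = g (n ℤ.+ + 2) ⊕ + 2 · g n ⊕ g (n ℤ.- + 1)
oddSumRHS g i = + 2 · g (i ℤ.+ + 2) ⊕ g i ⊖ g (i ℤ.- + 1)
evenSumRHS g i = + 2 · g (i ℤ.+ + 1) ⊕ g (i ℤ.- + 1) ⊖ g (i ℤ.- + 2)

module _ (g : ℤ → ℤ[i]) (g-rec : Tetranacci g) where

  private
    gʳ gⁱ : ℕ → ℤ
    gʳ = re ∘ g ∘ +_
    gⁱ = im ∘ g ∘ +_

    gʳ-rec : IsTetranacci gʳ
    gʳ-rec k = cong re (g-rec k)

    gⁱ-rec : IsTetranacci gⁱ
    gⁱ-rec k = cong im (g-rec k)

  sum-formula : ∀ m → + 3 · sum1 (suc m) (λ k → g (+ k))
                      ≡ sumRHS g (+ suc m) ⊖ (g (+ 3) ⊖ g (+ 1) ⊕ g (+ 0))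
  sum-formula = telescope (+ 3) _ (λ k → g (+ k)) (λ m → sumRHS g (+ suc m))
                  (componentwise (sum-base gʳ) (sum-base gⁱ)) step
    where
    step : ∀ m → sumRHS g (+ suc m) ⊕ + 3 · g (+ (2 ℕ.+ m)) ≡ sumRHS g (+ suc (suc m))
    step m rewrite ℕP.+-comm m 2 = componentwise (sum-step gʳ gʳ-rec m) (sum-step gⁱ gⁱ-rec m)

  odd-sum-formula : ∀ m → + 3 · sum1 (suc m) (λ k → g (+ 2 ℤ.* + k ℤ.+ + 1))
                          ≡ oddSumRHS g (+ 2 ℤ.* + suc m) ⊖ (+ 2 · g (+ 0) ⊕ g (+ 1) ⊕ + 3 · g (+ 2) ⊖ g (+ 3))
  odd-sum-formula = telescope (+ 3) _ (λ k → g (+ 2 ℤ.* + k ℤ.+ + 1)) (λ m → oddSumRHS g (+ 2 ℤ.* + suc m))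
                      (componentwise (odd-sum-base gʳ gʳ-rec) (odd-sum-base gⁱ gⁱ-rec))
                      (at-consecutive-evens (λ i j → oddSumRHS g i ⊕ + 3 · g (j ℤ.+ + 1) ≡ oddSumRHS g j) step)
    where
    step : ∀ p → oddSumRHS g (+ (2 ℕ.+ p)) ⊕ + 3 · g (+ (4 ℕ.+ p) ℤ.+ + 1) ≡ oddSumRHS g (+ (4 ℕ.+ p))
    step p rewrite ℕP.+-comm p 2 | ℕP.+-comm p 1 =
      componentwise (stride-step gʳ gʳ-rec (1 ℕ.+ p)) (stride-step gⁱ gⁱ-rec (1 ℕ.+ p))

  even-sum-formula : ∀ m → + 3 · sum1 (suc m) (λ k → g (+ 2 ℤ.* + k))
                           ≡ evenSumRHS g (+ 2 ℤ.* + suc m) ⊖ (+ 2 · g (+ 3) ⊕ g (+ 1) ⊖ g (+ 0) ⊖ + 3 · g (+ 2))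
  even-sum-formula = telescope (+ 3) _ (λ k → g (+ 2 ℤ.* + k)) (λ m → evenSumRHS g (+ 2 ℤ.* + suc m))
                       (componentwise (even-sum-base gʳ) (even-sum-base gⁱ))
                       (at-consecutive-evens (λ i j → evenSumRHS g i ⊕ + 3 · g j ≡ evenSumRHS g j) step)
    where
    step : ∀ p → evenSumRHS g (+ (2 ℕ.+ p)) ⊕ + 3 · g (+ (4 ℕ.+ p)) ≡ evenSumRHS g (+ (4 ℕ.+ p))
    step p rewrite ℕP.+-comm p 1 = componentwise (stride-step gʳ gʳ-rec p) (stride-step gⁱ gⁱ-rec p)

M-rec : ∀ k → M (+ (4 ℕ.+ k)) ≡ M (+ k) ℤ.+ M (+ (1 ℕ.+ k)) ℤ.+ M (+ (2 ℕ.+ k)) ℤ.+ M (+ (3 ℕ.+ k))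
M-rec k with tetraFwd k
... | (a , b , c , d) = refl

GM-tetranacci : Tetranacci GM
GM-tetranacci zero    = refl
GM-tetranacci (suc k) = componentwise (M-rec (suc k)) (M-rec k)

-- At g = GM the constants of the general formulas evaluate to 1 + i, 2 + 2i and 2 - i.
mainTheorem12 : ∀ (n : ℕ) → n ≥ 1 →
    (+ 3 · sum1 n (λ k → GM (+ k))
    ≡ GM (+ n ℤ.+ + 2) ⊕ + 2 · GM (+ n) ⊕ GM (+ n ℤ.- + 1) ⊖ ⟨ + 1 + + 1 i⟩)
    × (+ 3 · sum1 n (λ k → GM (+ 2 ℤ.* + k ℤ.+ + 1))
    ≡ + 2 · GM (+ 2 ℤ.* + n ℤ.+ + 2) ⊕ GM (+ 2 ℤ.* + n) ⊖ GM (+ 2 ℤ.* + n ℤ.- + 1) ⊖ ⟨ + 2 + + 2 i⟩)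
    × (+ 3 · sum1 n (λ k → GM (+ 2 ℤ.* + k))
    ≡ + 2 · GM (+ 2 ℤ.* + n ℤ.+ + 1) ⊕ GM (+ 2 ℤ.* + n ℤ.- + 1) ⊖ GM (+ 2 ℤ.* + n ℤ.- + 2) ⊖ ⟨ + 2 + ℤ.- (+ 1) i⟩)
mainTheorem12 (suc m) (s≤s _) =
    sum-formula GM GM-tetranacci m
  , odd-sum-formula GM GM-tetranacci m
  , even-sum-formula GM GM-tetranacci m
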